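{- For every integer $n \geq 5$, the number of permutations $\pi$ of $\{1,2,\dots,n\}$ which contain exactly one occurrence of the pattern $132$ and exactly one occurrence of the pattern $123$ equals $(n-3)(n-4)2^{n-5}$.
   Context: A permutation $\pi$ of $\{1,\dots,n\}$ is written as the sequence $\pi(1)\pi(2)\cdots\pi(n)$. An occurrence of the pattern $123$ in $\pi$ is a triple of indices $i<j<k$ with $\pi(i)<\pi(j)<\pi(k)$. An occurrence of the pattern $132$ in $\pi$ is a triple of indices $i<j<k$ with $\pi(i)<\pi(k)<\pi(j)$. -}

module Defs where

open import Data.Nat using (ℕ)
open import Data.Fin using (Fin; _<_; _<?_)
open import Data.Fin.Properties using (all?)
open import Data.Vec using (Vec; lookup)
open import Data.List using (List; length; filter; allFin; concatMap; [_]; []; _∷_)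
open import Data.Product using (_×_; _,_; proj₁; proj₂; Σ)
open import Relation.Nullary using (Dec; ¬_; yes; no)
open import Relation.Nullary.Decidable using (_×-dec_)
open import Relation.Unary using (Decidable)
open import Function.Definitions using (Injective)
open import Relation.Binary.PropositionalEquality using (_≡_)

-- A permutation of {1,…,n} in one-line notation π(1)…π(n), with values
-- encoded as Fin n (value v+1 ↦ v), positions indexed by Fin n.
IsPermutation : {n : ℕ} → Vec (Fin n) n → Set
IsPermutation {n} π = Injective _≡_ _≡_ (lookup π)

triples : (n : ℕ) → List (Fin n × Fin n × Fin n)
triples n = concatMap (λ i → concatMap (λ j → Data.List.map (λ k → (i , j , k)) (allFin n)) (allFin n)) (allFin n)

Occ123 : {n : ℕ} → Vec (Fin n) n → Fin n × Fin n × Fin n → Set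
Occ123 π (i , j , k) = (i < j) × (j < k) × (lookup π i < lookup π j) × (lookup π j < lookup π k)

Occ132 : {n : ℕ} → Vec (Fin n) n → Fin n × Fin n × Fin n → Set
Occ132 π (i , j , k) = (i < j) × (j < k) × (lookup π i < lookup π k) × (lookup π k < lookup π j)

occ123? : {n : ℕ} (π : Vec (Fin n) n) → Decidable (Occ123 π)
occ123? π (i , j , k) = (i <? j) ×-dec ((j <? k) ×-dec ((lookup π i <? lookup π j) ×-dec (lookup π j <? lookup π k)))

occ132? : {n : ℕ} (π : Vec (Fin n) n) → Decidable (Occ132 π)
occ132? π (i , j , k) = (i <? j) ×-dec ((j <? k) ×-dec ((lookup π i <? lookup π k) ×-dec (lookup π k <? lookup π j)))

count123 : {n : ℕ} → Vec (Fin n) n → ℕ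
count123 {n} π = length (filter (occ123? π) (triples n))

count132 : {n : ℕ} → Vec (Fin n) n → ℕ
count132 {n} π = length (filter (occ132? π) (triples n))

module Submission where

-- Write a permutation of {0, …, n−1} as its first value x followed by a permutation σ of
-- {0, …, n−2} relabelled by punchIn x. The occurrences of 123 (resp. 132) starting at x
-- correspond to the increasing (resp. decreasing) pairs of values ≥ x in σ, and there are
-- C(n−1−x, 2) such pairs altogether. So if each pattern occurs at most once, x is one of the
-- three largest values: x = n−1 or n−2 creates no occurrence, and x = n−3 creates exactly one,
-- a 123 or a 132 according as the two largest values of σ occur in increasing or decreasing
-- order. Recording the numbers a, b ∈ {0, 1} of 123s and 132s and this order o gives a
-- recursion on (a, b, o), realised by a duplicate-free list of permutations; solving it gives
-- 2^(n−1) for a = b = 0, (n−2) 2^(n−3) for a + b = 1 and (n−3)(n−4) 2^(n−5) for a = b = 1.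

open import Defs
open import Data.Bool using (Bool; true; false; not; _∧_; if_then_else_)
open import Data.Bool.Properties using (∧-zeroʳ; ∧-identityʳ)
open import Data.Fin as Fin using (Fin; toℕ)
open import Data.Fin.Properties
  using (toℕ-fromℕ<; fromℕ<-injective; toℕ-injective; toℕ<n; punchIn-injective; punchInᵢ≢i; punchIn-punchOut; punchOut-injective)
  renaming (suc-injective to Fin-suc-injective)
open import Data.List using (List; []; _∷_; _++_; length; filter; concatMap; map; tabulate)
open import Data.List.Membership.Propositional using (_∈_)
open import Data.List.Membership.Propositional.Properties using (∈-map⁺; ∈-map⁻; ∈-++⁺ˡ; ∈-++⁺ʳ; ∈-++⁻)
open import Data.List.Properties using (filter-++; length-++; length-map)
open import Data.List.Relation.Binary.Disjoint.Propositional using (Disjoint)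
open import Data.List.Relation.Unary.All using ([])
open import Data.List.Relation.Unary.AllPairs using ([]; _∷_)
open import Data.List.Relation.Unary.Any using (here)
open import Data.List.Relation.Unary.Unique.Propositional using (Unique)
open import Data.List.Relation.Unary.Unique.Propositional.Properties using (++⁺; map⁺)
open import Data.Nat using (ℕ; zero; suc; _+_; _*_; _∸_; _^_; _≤_; _<_; _≤ᵇ_; _<ᵇ_; _≟_; z≤n; s≤s; s<s; s<s⁻¹)
open import Data.Nat.Properties
  using (_≤?_; _<?_; ≤-refl; ≤-trans; ≤-reflexive; ≤-pred; <-trans; <-≤-trans; <-irrefl; ≮⇒≥; ≰⇒>; <⇒≱; <⇒≯; ≤⇒≯;
         ≤∧≢⇒<; n≤1+n; n<1+n; m≤n⇒m≤1+n; m≤m+n; m≤n+m; +-mono-≤; +-identityʳ; suc-injective; m+n≡0⇒m≡0; m+n≡0⇒n≡0;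
         0∸n≡0; n∸n≡0; m+n∸n≡m; +-∸-assoc; m+n≤o⇒m≤o∸n; *-cancelˡ-≡; m≤n⇒∃[o]m+o≡n; +-commutativeSemigroup; module ≤-Reasoning)
open import Data.Nat.Tactic.RingSolver using (solve-∀)
open import Data.Product using (Σ; _×_; _,_; proj₁; proj₂; map₂)
open import Data.Product.Properties using (,-injectiveˡ; ,-injectiveʳ)
open import Data.Sum using (inj₁; inj₂; [_,_]′)
open import Data.Vec as Vec using (Vec; lookup)
open import Data.Vec.Properties using (lookup-map; tabulate-∘; tabulate∘lookup; tabulate-cong; lookup∘tabulate; ∷-injectiveˡ; ∷-injectiveʳ)
open import Function.Base using (_∘_)
open import Function.Bundles using (_⇔_; mk⇔; Equivalence)
open import Relation.Binary.PropositionalEquality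
open import Relation.Nullary using (does; yes; no; ¬_; contradiction)
open import Relation.Nullary.Decidable using (dec-true; dec-false)
open import Relation.Unary using (Decidable)
open import Algebra.Properties.CommutativeSemigroup +-commutativeSemigroup using () renaming (interchange to +-interchange)

indicator : Bool → ℕ
indicator true  = 1
indicator false = 0

module _ {A : Set} where

  count : (A → Bool) → List A → ℕ
  count p []      = 0
  count p (w ∷ v) = indicator (p w) + count p v

  countPairs : (A → A → Bool) → List A → ℕ
  countPairs R []      = 0
  countPairs R (z ∷ v) = count (R z) v + countPairs R v

  countTriples : (A → A → A → Bool) → List A → ℕ
  countTriples R []      = 0
  countTriples R (y ∷ v) = countPairs (R y) v + countTriples R v

  count-none : ∀ {p : A → Bool} → (∀ w → p w ≡ false) → ∀ v → count p v ≡ 0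
  count-none p≗false []      = refl
  count-none p≗false (w ∷ v) rewrite p≗false w = count-none p≗false v

  count-+ : ∀ {p q r : A → Bool} → (∀ w → indicator (p w) + indicator (q w) ≡ indicator (r w)) →
    ∀ v → count p v + count q v ≡ count r v
  count-+ p+q≗r []      = refl
  count-+ {p} {q} {r} p+q≗r (w ∷ v) = begin
    (indicator (p w) + count p v) + (indicator (q w) + count q v)
      ≡⟨ +-interchange (indicator (p w)) (count p v) _ _ ⟩
    (indicator (p w) + indicator (q w)) + (count p v + count q v)
      ≡⟨ cong₂ _+_ (p+q≗r w) (count-+ p+q≗r v) ⟩
    indicator (r w) + count r v ∎
    where open ≡-Reasoning

module _ {A B : Set} where

  count-map : ∀ {p : A → Bool} {q : B → Bool} {f : B → A} →
    (∀ w → p (f w) ≡ q w) → ∀ v → count p (map f v) ≡ count q v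
  count-map pf≗q []      = refl
  count-map pf≗q (w ∷ v) = cong₂ _+_ (cong indicator (pf≗q w)) (count-map pf≗q v)

  countPairs-map : ∀ {R : A → A → Bool} {S : B → B → Bool} {f : B → A} →
    (∀ y z → R (f y) (f z) ≡ S y z) → ∀ v → countPairs R (map f v) ≡ countPairs S v
  countPairs-map Rf≗S []      = refl
  countPairs-map Rf≗S (z ∷ v) = cong₂ _+_ (count-map (Rf≗S z) v) (countPairs-map Rf≗S v)

  countTriples-map : ∀ {R : A → A → A → Bool} {S : B → B → B → Bool} {f : B → A} →
    (∀ x y z → R (f x) (f y) (f z) ≡ S x y z) → ∀ v → countTriples R (map f v) ≡ countTriples S v
  countTriples-map Rf≗S []      = refl
  countTriples-map Rf≗S (y ∷ v) = cong₂ _+_ (countPairs-map (Rf≗S y) v) (countTriples-map Rf≗S v)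

indicator-injective : ∀ {b c} → indicator b ≡ indicator c → b ≡ c
indicator-injective {true}  {true}  _ = refl
indicator-injective {false} {false} _ = refl

indicator≤1 : ∀ b → indicator b ≤ 1
indicator≤1 true  = s≤s z≤n
indicator≤1 false = z≤n

suc≡indicator : ∀ {n} b → suc n ≡ indicator b → b ≡ true × n ≡ 0
suc≡indicator true refl = refl , refl

indicator-complement : ∀ b {n} → indicator b + n ≡ 1 → n ≡ indicator (not b)
indicator-complement true  1+n≡1 = suc-injective 1+n≡1
indicator-complement false n≡1   = n≡1

+≡1⇒indicator : ∀ m {n} → m + n ≡ 1 → Σ Bool λ b → m ≡ indicator b
+≡1⇒indicator zero          _  = false , refl
+≡1⇒indicator (suc zero)    _  = true , refl
+≡1⇒indicator (suc (suc m)) ()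

is123 is132 : ℕ → ℕ → ℕ → Bool
is123 x y z = (x <ᵇ y) ∧ (y <ᵇ z)
is132 x y z = (x <ᵇ z) ∧ (z <ᵇ y)

counts : List ℕ → ℕ × ℕ
counts l = countTriples is123 l , countTriples is132 l

-- Pattern counts of a vector as counts of its list of values

∑ : ∀ n → (Fin n → ℕ) → ℕ
∑ zero    f = 0
∑ (suc n) f = f Fin.zero + ∑ n (λ i → f (Fin.suc i))

∑-cong : ∀ n {f g : Fin n → ℕ} → (∀ i → f i ≡ g i) → ∑ n f ≡ ∑ n g
∑-cong zero    f≗g = refl
∑-cong (suc n) f≗g = cong₂ _+_ (f≗g Fin.zero) (∑-cong n (λ i → f≗g (Fin.suc i)))

∑-zero : ∀ n → ∑ n (λ _ → 0) ≡ 0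
∑-zero zero    = refl
∑-zero (suc n) = ∑-zero n

module _ {A : Set} {P : A → Set} (P? : Decidable P) where

  length-filter-++ : ∀ xs ys → length (filter P? (xs ++ ys)) ≡ length (filter P? xs) + length (filter P? ys)
  length-filter-++ xs ys = trans (cong length (filter-++ P? xs ys)) (length-++ (filter P? xs))

  length-filter-concatMap : ∀ {B : Set} n (f : Fin n → B) (g : B → List A) →
    length (filter P? (concatMap g (tabulate f))) ≡ ∑ n (λ i → length (filter P? (g (f i))))
  length-filter-concatMap zero    f g = refl
  length-filter-concatMap (suc n) f g =
    trans (length-filter-++ (g (f Fin.zero)) _)
          (cong (length (filter P? (g (f Fin.zero))) +_) (length-filter-concatMap n (λ i → f (Fin.suc i)) g))

  length-filter-map : ∀ {B : Set} n (f : Fin n → B) (h : B → A) →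
    length (filter P? (map h (tabulate f))) ≡ ∑ n (λ i → indicator (does (P? (h (f i)))))
  length-filter-map zero    f h = refl
  length-filter-map (suc n) f h with does (P? (h (f Fin.zero)))
  ... | true  = cong suc (length-filter-map n (λ i → f (Fin.suc i)) h)
  ... | false = length-filter-map n (λ i → f (Fin.suc i)) h

length-filter-triples : ∀ n {P : Fin n × Fin n × Fin n → Set} (P? : Decidable P) →
  length (filter P? (triples n)) ≡ ∑ n (λ i → ∑ n (λ j → ∑ n (λ k → indicator (does (P? (i , j , k))))))
length-filter-triples n P? =
  trans (length-filter-concatMap P? n (λ i → i) _) (∑-cong n (λ i →
  trans (length-filter-concatMap P? n (λ j → j) _) (∑-cong n (λ j →
  length-filter-map P? n (λ k → k) _))))

values : ∀ {m n} → Vec (Fin m) n → List ℕ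
values π = Vec.toList (Vec.map toℕ π)

module _ (R : ℕ → ℕ → ℕ → Bool) where

  private
    val : ∀ {m n} → Vec (Fin m) n → Fin n → ℕ
    val v i = toℕ (lookup v i)

    _<ᶠ_ : ∀ {n} → Fin n → Fin n → Bool
    i <ᶠ j = toℕ i <ᵇ toℕ j

  ∑-count : ∀ y z {m n} (v : Vec (Fin m) n) → ∑ n (λ i → indicator (R y z (val v i))) ≡ count (R y z) (values v)
  ∑-count y z Vec.[]      = refl
  ∑-count y z (w Vec.∷ v) = cong (indicator (R y z (toℕ w)) +_) (∑-count y z v)

  ∑-countPairs : ∀ y {m n} (v : Vec (Fin m) n) →
    ∑ n (λ j → ∑ n (λ k → indicator (j <ᶠ k ∧ R y (val v j) (val v k)))) ≡ countPairs (R y) (values v)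
  ∑-countPairs y Vec.[]      = refl
  ∑-countPairs y (z Vec.∷ v) = cong₂ _+_ (∑-count y (toℕ z) v) (∑-countPairs y v)

  ∑-countTriples : ∀ {m n} (v : Vec (Fin m) n) →
    ∑ n (λ i → ∑ n (λ j → ∑ n (λ k → indicator (i <ᶠ j ∧ (j <ᶠ k ∧ R (val v i) (val v j) (val v k))))))
      ≡ countTriples R (values v)
  ∑-countTriples Vec.[] = refl
  ∑-countTriples {n = suc n} (x Vec.∷ v) = cong₂ _+_
    (trans (zero+ _ (∑-zero (suc n))) (∑-countPairs (toℕ x) v))
    (trans (∑-cong n (λ i → trans (zero+ _ (∑-zero (suc n)))
             (∑-cong n (λ j → zero+ _ (cong indicator (∧-zeroʳ (i <ᶠ j)))))))
       (∑-countTriples v))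
    where
    zero+ : ∀ {a} c → a ≡ 0 → a + c ≡ c
    zero+ c refl = refl

-- `does (occ123? π (i , j , k))` computes to the Boolean comparisons of `is123`, and likewise for 132.
count123≡countTriples : ∀ {n} (π : Vec (Fin n) n) → count123 π ≡ countTriples is123 (values π)
count123≡countTriples {n} π = trans (length-filter-triples n (occ123? π)) (∑-countTriples is123 π)

count132≡countTriples : ∀ {n} (π : Vec (Fin n) n) → count132 π ≡ countTriples is132 (values π)
count132≡countTriples {n} π = trans (length-filter-triples n (occ132? π)) (∑-countTriples is132 π)

counts-values : ∀ {n} (π : Vec (Fin n) n) → counts (values π) ≡ (count123 π , count132 π)
counts-values π = sym (cong₂ _,_ (count123≡countTriples π) (count132≡countTriples π))

punchInℕ : ℕ → ℕ → ℕ
punchInℕ x w with w <? x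
... | yes _ = w
... | no  _ = suc w

<ᵇ-true : ∀ {a b} → a < b → (a <ᵇ b) ≡ true
<ᵇ-true {a} {b} = dec-true (a <? b)

<ᵇ-false : ∀ {a b} → ¬ a < b → (a <ᵇ b) ≡ false
<ᵇ-false {a} {b} = dec-false (a <? b)

≤ᵇ-true : ∀ {a b} → a ≤ b → (a ≤ᵇ b) ≡ true
≤ᵇ-true {a} {b} = dec-true (a ≤? b)

≤ᵇ-false : ∀ {a b} → ¬ a ≤ b → (a ≤ᵇ b) ≡ false
≤ᵇ-false {a} {b} = dec-false (a ≤? b)

punchInℕ-<ᵇ : ∀ x a b → (punchInℕ x a <ᵇ punchInℕ x b) ≡ (a <ᵇ b)
punchInℕ-<ᵇ x a b with a <? x | b <? x
... | yes _   | yes _   = refl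
... | no  _   | no  _   = refl
... | yes a<x | no  b≮x = trans (<ᵇ-true (<-≤-trans a<x (≤-trans (≮⇒≥ b≮x) (n≤1+n b))))
                                (sym (<ᵇ-true (<-≤-trans a<x (≮⇒≥ b≮x))))
... | no  a≮x | yes b<x = trans (<ᵇ-false (λ 1+a<b → a≮x (<-trans (<-trans (n<1+n a) 1+a<b) b<x)))
                                (sym (<ᵇ-false (λ a<b → a≮x (<-trans a<b b<x))))

punchInℕ-<ᵇ-self : ∀ x w → (punchInℕ x w <ᵇ x) ≡ (w <ᵇ x)
punchInℕ-<ᵇ-self x w with w <? x
... | yes _   = refl
... | no  w≮x = trans (<ᵇ-false (λ 1+w<x → w≮x (<-trans (n<1+n w) 1+w<x))) (sym (<ᵇ-false w≮x))

punchInℕ-≤ᵇ : ∀ {t x} w → t ≤ x → (t ≤ᵇ punchInℕ x w) ≡ (t ≤ᵇ w)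
punchInℕ-≤ᵇ {t} {x} w t≤x with w <? x
... | yes _   = refl
... | no  w≮x = trans (≤ᵇ-true (m≤n⇒m≤1+n t≤w)) (sym (≤ᵇ-true t≤w))
  where t≤w = ≤-trans t≤x (≮⇒≥ w≮x)

punchInℕ-suc-≤ᵇ : ∀ {t x} w → x ≤ t → (suc t ≤ᵇ punchInℕ x w) ≡ (t ≤ᵇ w)
punchInℕ-suc-≤ᵇ {t} {x} w x≤t with w <? x | t ≤? w
... | yes w<x | _       = trans (≤ᵇ-false (λ 1+t≤w → <⇒≱ w<x (≤-trans x≤t (≤-trans (n≤1+n t) 1+t≤w))))
                                (sym (≤ᵇ-false (λ t≤w → <⇒≱ w<x (≤-trans x≤t t≤w))))
... | no  _   | yes t≤w = trans (≤ᵇ-true (s≤s t≤w)) (sym (≤ᵇ-true t≤w))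
... | no  _   | no  t≰w = trans (≤ᵇ-false (λ 1+t≤1+w → t≰w (≤-pred 1+t≤1+w))) (sym (≤ᵇ-false t≰w))

<ᵇ-punchInℕ : ∀ x w → (x <ᵇ punchInℕ x w) ≡ (x ≤ᵇ w)
<ᵇ-punchInℕ x w with w <? x
... | yes w<x = trans (<ᵇ-false (<⇒≯ w<x)) (sym (≤ᵇ-false (<⇒≱ w<x)))
... | no  w≮x = trans (<ᵇ-true (s≤s (≮⇒≥ w≮x))) (sym (≤ᵇ-true (≮⇒≥ w≮x)))

-- Ascents and descents above a threshold

choose2 : ℕ → ℕ
choose2 zero    = 0
choose2 (suc n) = n + choose2 n

-- Increasing and decreasing pairs among the values ≥ t; `countPairs (is123 x)` is `ascentsFrom (suc x)` by definition.
ascentsFrom descentsFrom : ℕ → List ℕ → ℕ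
ascentsFrom  t = countPairs (λ y z → (t ≤ᵇ y) ∧ (y <ᵇ z))
descentsFrom t = countPairs (λ y z → (t ≤ᵇ z) ∧ (z <ᵇ y))

ascentsFrom-punchIn : ∀ {t x} → t ≤ x → ∀ l → ascentsFrom t (map (punchInℕ x) l) ≡ ascentsFrom t l
ascentsFrom-punchIn {x = x} t≤x = countPairs-map (λ y z → cong₂ _∧_ (punchInℕ-≤ᵇ y t≤x) (punchInℕ-<ᵇ x y z))

descentsFrom-punchIn : ∀ {t x} → t ≤ x → ∀ l → descentsFrom t (map (punchInℕ x) l) ≡ descentsFrom t l
descentsFrom-punchIn {x = x} t≤x = countPairs-map (λ y z → cong₂ _∧_ (punchInℕ-≤ᵇ z t≤x) (punchInℕ-<ᵇ x z y))

ascentsFrom-suc-punchIn : ∀ {t x} → x ≤ t → ∀ l → ascentsFrom (suc t) (map (punchInℕ x) l) ≡ ascentsFrom t l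
ascentsFrom-suc-punchIn {x = x} x≤t = countPairs-map (λ y z → cong₂ _∧_ (punchInℕ-suc-≤ᵇ y x≤t) (punchInℕ-<ᵇ x y z))

descentsFrom-suc-punchIn : ∀ {t x} → x ≤ t → ∀ l → descentsFrom (suc t) (map (punchInℕ x) l) ≡ descentsFrom t l
descentsFrom-suc-punchIn {x = x} x≤t = countPairs-map (λ y z → cong₂ _∧_ (punchInℕ-suc-≤ᵇ z x≤t) (punchInℕ-<ᵇ x z y))

ascentsFrom-insert-below : ∀ {t} x → x ≤ t → ∀ l → ascentsFrom (suc t) (x ∷ map (punchInℕ x) l) ≡ ascentsFrom t l
ascentsFrom-insert-below {t} x x≤t l = cong₂ _+_
  (count-none (λ z → cong (_∧ (x <ᵇ z)) (≤ᵇ-false (<⇒≱ (s≤s x≤t)))) (map (punchInℕ x) l))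
  (ascentsFrom-suc-punchIn x≤t l)

descentsFrom-insert-below : ∀ {t} x → x ≤ t → ∀ l → descentsFrom (suc t) (x ∷ map (punchInℕ x) l) ≡ descentsFrom t l
descentsFrom-insert-below {t} x x≤t l = cong₂ _+_ (count-none outside (map (punchInℕ x) l)) (descentsFrom-suc-punchIn x≤t l)
  where
  outside : ∀ z → ((suc t ≤ᵇ z) ∧ (z <ᵇ x)) ≡ false
  outside z with z <? x
  ... | yes z<x rewrite ≤ᵇ-false {suc t} {z} (λ 1+t≤z → <⇒≱ z<x (≤-trans x≤t (≤-trans (n≤1+n t) 1+t≤z))) = refl
  ... | no  z≮x rewrite <ᵇ-false z≮x = ∧-zeroʳ _

count123-insert : ∀ x l → countTriples is123 (x ∷ map (punchInℕ x) l) ≡ ascentsFrom x l + countTriples is123 l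
count123-insert x l = cong₂ _+_ (ascentsFrom-suc-punchIn ≤-refl l)
  (countTriples-map (λ a b c → cong₂ _∧_ (punchInℕ-<ᵇ x a b) (punchInℕ-<ᵇ x b c)) l)

count132-insert : ∀ x l → countTriples is132 (x ∷ map (punchInℕ x) l) ≡ descentsFrom x l + countTriples is132 l
count132-insert x l = cong₂ _+_ (descentsFrom-suc-punchIn ≤-refl l)
  (countTriples-map (λ a b c → cong₂ _∧_ (punchInℕ-<ᵇ x a c) (punchInℕ-<ᵇ x c b)) l)

data PermList : ℕ → List ℕ → Set where
  []     : PermList 0 []
  insert : ∀ {m l} x → x ≤ m → PermList m l → PermList (suc m) (x ∷ map (punchInℕ x) l)

count-≥ : ∀ {m l} → PermList m l → ∀ t → count (t ≤ᵇ_) l ≡ m ∸ t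
count-≥ [] t = sym (0∸n≡0 t)
count-≥ (insert {l = l} x x≤m σ) t with t ≤? x
... | yes t≤x rewrite ≤ᵇ-true t≤x =
  trans (cong suc (trans (count-map (λ w → punchInℕ-≤ᵇ w t≤x) l) (count-≥ σ t)))
        (sym (+-∸-assoc 1 (≤-trans t≤x x≤m)))
count-≥ (insert x x≤m σ) zero    | no 0≰x = contradiction z≤n 0≰x
count-≥ (insert {l = l} x x≤m σ) (suc t) | no 1+t≰x rewrite ≤ᵇ-false 1+t≰x =
  trans (count-map (λ w → punchInℕ-suc-≤ᵇ w (≤-pred (≰⇒> 1+t≰x))) l) (count-≥ σ t)

ascentsFrom-insert : ∀ {m l t} x → t ≤ x → PermList m l →
  ascentsFrom t (x ∷ map (punchInℕ x) l) ≡ (m ∸ x) + ascentsFrom t l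
ascentsFrom-insert {l = l} x t≤x σ rewrite ≤ᵇ-true t≤x =
  cong₂ _+_ (trans (count-map (<ᵇ-punchInℕ x) l) (count-≥ σ x)) (ascentsFrom-punchIn t≤x l)

indicator-split : ∀ {t x} → t ≤ x → ∀ w →
  indicator (x ≤ᵇ w) + indicator ((t ≤ᵇ w) ∧ (w <ᵇ x)) ≡ indicator (t ≤ᵇ w)
indicator-split {t} {x} t≤x w with x ≤? w
... | yes x≤w rewrite ≤ᵇ-true x≤w | ≤ᵇ-true (≤-trans t≤x x≤w) | <ᵇ-false (≤⇒≯ x≤w) = refl
... | no  x≰w rewrite ≤ᵇ-false x≰w | <ᵇ-true (≰⇒> x≰w) = cong indicator (∧-identityʳ (t ≤ᵇ w))

ascents+descents : ∀ {m l} → PermList m l → ∀ t → ascentsFrom t l + descentsFrom t l ≡ choose2 (m ∸ t)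
ascents+descents [] t = cong choose2 (sym (0∸n≡0 t))
ascents+descents (insert {m} {l} x x≤m σ) t with t ≤? x
... | yes t≤x = begin
  ascentsFrom t (x ∷ map (punchInℕ x) l) + descentsFrom t (x ∷ map (punchInℕ x) l)
    ≡⟨ cong₂ _+_ (ascentsFrom-insert x t≤x σ)
                 (cong₂ _+_ (count-map (λ w → cong₂ _∧_ (punchInℕ-≤ᵇ w t≤x) (punchInℕ-<ᵇ-self x w)) l)
                            (descentsFrom-punchIn t≤x l)) ⟩
  ((m ∸ x) + ascentsFrom t l) + (count (λ w → (t ≤ᵇ w) ∧ (w <ᵇ x)) l + descentsFrom t l)
    ≡⟨ +-interchange (m ∸ x) _ _ _ ⟩
  ((m ∸ x) + count (λ w → (t ≤ᵇ w) ∧ (w <ᵇ x)) l) + (ascentsFrom t l + descentsFrom t l)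
    ≡⟨ cong₂ _+_ (trans (cong (_+ count (λ w → (t ≤ᵇ w) ∧ (w <ᵇ x)) l) (sym (count-≥ σ x))) (trans (count-+ (indicator-split t≤x) l) (count-≥ σ t)))
                 (ascents+descents σ t) ⟩
  (m ∸ t) + choose2 (m ∸ t)
    ≡⟨ cong choose2 (sym (+-∸-assoc 1 (≤-trans t≤x x≤m))) ⟩
  choose2 (suc m ∸ t) ∎
  where open ≡-Reasoning
ascents+descents (insert x x≤m σ) zero    | no 0≰x = contradiction z≤n 0≰x
ascents+descents (insert {l = l} x x≤m σ) (suc t) | no 1+t≰x =
  trans (cong₂ _+_ (ascentsFrom-insert-below x x≤t l) (descentsFrom-insert-below x x≤t l)) (ascents+descents σ t)
  where x≤t = ≤-pred (≰⇒> 1+t≰x)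

choose2-≤1 : ∀ {n} → n ≤ 1 → choose2 n ≡ 0
choose2-≤1 z≤n       = refl
choose2-≤1 (s≤s z≤n) = refl

3≤choose2 : ∀ {n} → 3 ≤ n → 3 ≤ choose2 n
3≤choose2 {suc (suc (suc n))} _ = +-mono-≤ {2} {2 + n} {1} (s≤s (s≤s z≤n)) (s≤s z≤n)
3≤choose2 {suc zero}       (s≤s ())
3≤choose2 {suc (suc zero)} (s≤s (s≤s ()))

ascentsFrom-vanishes : ∀ {m l t} → PermList m l → m ∸ t ≤ 1 → ascentsFrom t l ≡ 0
ascentsFrom-vanishes {t = t} σ m∸t≤1 = m+n≡0⇒m≡0 _ (trans (ascents+descents σ t) (choose2-≤1 m∸t≤1))

descentsFrom-vanishes : ∀ {m l t} → PermList m l → m ∸ t ≤ 1 → descentsFrom t l ≡ 0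
descentsFrom-vanishes {t = t} σ m∸t≤1 = m+n≡0⇒n≡0 _ (trans (ascents+descents σ t) (choose2-≤1 m∸t≤1))

counts-insert : ∀ x l → counts (x ∷ map (punchInℕ x) l) ≡ (ascentsFrom x l + countTriples is123 l , descentsFrom x l + countTriples is132 l)
counts-insert x l = cong₂ _,_ (count123-insert x l) (count132-insert x l)

punchInℕ-suc : ∀ a b → punchInℕ (suc a) (suc b) ≡ suc (punchInℕ a b)
punchInℕ-suc a b with suc b <? suc a | b <? a
... | yes _       | yes _   = refl
... | no  _       | no  _   = refl
... | yes 1+b<1+a | no  b≮a = contradiction (s<s⁻¹ 1+b<1+a) b≮a
... | no  1+b≮1+a | yes b<a = contradiction (s<s b<a) 1+b≮1+a

toℕ-punchIn : ∀ {m} (x : Fin (suc m)) (y : Fin m) → toℕ (Fin.punchIn x y) ≡ punchInℕ (toℕ x) (toℕ y)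
toℕ-punchIn Fin.zero    y        = refl
toℕ-punchIn (Fin.suc x) Fin.zero = refl
toℕ-punchIn (Fin.suc x) (Fin.suc y) = trans (cong suc (toℕ-punchIn x y)) (sym (punchInℕ-suc (toℕ x) (toℕ y)))

prepend : ∀ {m} → Fin (suc m) → Vec (Fin m) m → Vec (Fin (suc m)) (suc m)
prepend x σ = x Vec.∷ Vec.map (Fin.punchIn x) σ

values-map-punchIn : ∀ {m n} (x : Fin (suc m)) (σ : Vec (Fin m) n) →
  values (Vec.map (Fin.punchIn x) σ) ≡ map (punchInℕ (toℕ x)) (values σ)
values-map-punchIn x Vec.[]      = refl
values-map-punchIn x (y Vec.∷ σ) = cong₂ _∷_ (toℕ-punchIn x y) (values-map-punchIn x σ)

values-prepend : ∀ {m v} (x : Fin (suc m)) (σ : Vec (Fin m) m) → toℕ x ≡ v →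
  values (prepend x σ) ≡ v ∷ map (punchInℕ v) (values σ)
values-prepend x σ refl = cong (toℕ x ∷_) (values-map-punchIn x σ)

map-punchIn-injective : ∀ {m n} (x : Fin (suc m)) {σ τ : Vec (Fin m) n} →
  Vec.map (Fin.punchIn x) σ ≡ Vec.map (Fin.punchIn x) τ → σ ≡ τ
map-punchIn-injective x {Vec.[]}    {Vec.[]}    _ = refl
map-punchIn-injective x {a Vec.∷ σ} {b Vec.∷ τ} e =
  cong₂ Vec._∷_ (punchIn-injective x a b (∷-injectiveˡ e)) (map-punchIn-injective x (∷-injectiveʳ e))

prepend-injectiveʳ : ∀ {m} (x : Fin (suc m)) {σ τ : Vec (Fin m) m} → prepend x σ ≡ prepend x τ → σ ≡ τ
prepend-injectiveʳ x e = map-punchIn-injective x (∷-injectiveʳ e)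

prepend-isPermutation : ∀ {m} (x : Fin (suc m)) {σ : Vec (Fin m) m} → IsPermutation σ → IsPermutation (prepend x σ)
prepend-isPermutation x         {σ} _  {Fin.zero}  {Fin.zero}  _ = refl
prepend-isPermutation x         {σ} _  {Fin.zero}  {Fin.suc j} e =
  contradiction (sym (trans e (lookup-map j (Fin.punchIn x) σ))) (punchInᵢ≢i x (lookup σ j))
prepend-isPermutation x         {σ} _  {Fin.suc i} {Fin.zero}  e =
  contradiction (trans (sym (lookup-map i (Fin.punchIn x) σ)) e) (punchInᵢ≢i x (lookup σ i))
prepend-isPermutation x         {σ} pσ {Fin.suc i} {Fin.suc j} e = cong Fin.suc (pσ (punchIn-injective x _ _
  (trans (sym (lookup-map i (Fin.punchIn x) σ)) (trans e (lookup-map j (Fin.punchIn x) σ)))))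

prepend-surjective : ∀ {m} (π : Vec (Fin (suc m)) (suc m)) → IsPermutation π →
  Σ (Fin (suc m)) λ x → Σ (Vec (Fin m) m) λ σ → IsPermutation σ × prepend x σ ≡ π
prepend-surjective {m} (x Vec.∷ τ) pπ = x , σ , σ-isPermutation , prepend-x-σ≡π
  where
  x≢τ : ∀ i → x ≢ lookup τ i
  x≢τ i e with pπ {Fin.zero} {Fin.suc i} e
  ... | ()
  σ : Vec (Fin m) m
  σ = Vec.tabulate (λ i → Fin.punchOut (x≢τ i))
  σ-isPermutation : IsPermutation σ
  σ-isPermutation {i} {j} e = Fin-suc-injective (pπ (punchOut-injective (x≢τ i) (x≢τ j)
    (trans (sym (lookup∘tabulate _ i)) (trans e (lookup∘tabulate _ j)))))
  prepend-x-σ≡π : prepend x σ ≡ x Vec.∷ τ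
  prepend-x-σ≡π = cong (x Vec.∷_) (begin
    Vec.map (Fin.punchIn x) σ                       ≡⟨ tabulate-∘ (Fin.punchIn x) _ ⟨
    Vec.tabulate (λ i → Fin.punchIn x (Fin.punchOut (x≢τ i))) ≡⟨ tabulate-cong (λ i → punchIn-punchOut (x≢τ i)) ⟩
    Vec.tabulate (lookup τ)                         ≡⟨ tabulate∘lookup τ ⟩
    τ                                               ∎)
    where open ≡-Reasoning

isPermutation⇒PermList : ∀ {n} (π : Vec (Fin n) n) → IsPermutation π → PermList n (values π)
isPermutation⇒PermList {zero}  Vec.[] _ = []
isPermutation⇒PermList {suc m} π pπ with prepend-surjective π pπ
... | x , σ , pσ , refl rewrite values-prepend x σ refl = insert (toℕ x) (≤-pred (toℕ<n x)) (isPermutation⇒PermList σ pσ)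

-- The effect of the first entry on the pattern counts

-- For a list of length k + 2: a and b are the numbers of 123s and 132s, and o says whether the
-- two largest values k and 1 + k occur in increasing order.
HasStats : ℕ → List ℕ → Bool → Bool → Bool → Set
HasStats k l a b o = counts l ≡ (indicator a , indicator b) × ascentsFrom k l ≡ indicator o

module Insertion {k l} (σ : PermList (2 + k) l) where

  private
    [2+k]∸[2+k]≤1 : 2 + k ∸ (2 + k) ≤ 1
    [2+k]∸[2+k]≤1 = ≤-trans (≤-reflexive (n∸n≡0 k)) z≤n

    [2+k]∸[1+k]≡1 : 2 + k ∸ (1 + k) ≡ 1
    [2+k]∸[1+k]≡1 = m+n∸n≡m 1 k

  counts-largest : counts (2 + k ∷ map (punchInℕ (2 + k)) l) ≡ counts l
  counts-largest = trans (counts-insert (2 + k) l) (cong₂ _,_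
    (cong (_+ countTriples is123 l) (ascentsFrom-vanishes σ [2+k]∸[2+k]≤1))
    (cong (_+ countTriples is132 l) (descentsFrom-vanishes σ [2+k]∸[2+k]≤1)))

  order-largest : ascentsFrom (1 + k) (2 + k ∷ map (punchInℕ (2 + k)) l) ≡ 0
  order-largest = trans (ascentsFrom-insert (2 + k) (n≤1+n _) σ)
    (cong₂ _+_ (n∸n≡0 k) (ascentsFrom-vanishes σ (≤-reflexive [2+k]∸[1+k]≡1)))

  counts-second : counts (1 + k ∷ map (punchInℕ (1 + k)) l) ≡ counts l
  counts-second = trans (counts-insert (1 + k) l) (cong₂ _,_
    (cong (_+ countTriples is123 l) (ascentsFrom-vanishes σ (≤-reflexive [2+k]∸[1+k]≡1)))
    (cong (_+ countTriples is132 l) (descentsFrom-vanishes σ (≤-reflexive [2+k]∸[1+k]≡1))))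

  order-second : ascentsFrom (1 + k) (1 + k ∷ map (punchInℕ (1 + k)) l) ≡ 1
  order-second = trans (ascentsFrom-insert (1 + k) ≤-refl σ)
    (cong₂ _+_ [2+k]∸[1+k]≡1 (ascentsFrom-vanishes σ (≤-reflexive [2+k]∸[1+k]≡1)))

  order-third : ascentsFrom (1 + k) (k ∷ map (punchInℕ k) l) ≡ ascentsFrom k l
  order-third = ascentsFrom-insert-below k ≤-refl l

  ascents+descents-third : ascentsFrom k l + descentsFrom k l ≡ 1
  ascents+descents-third = trans (ascents+descents σ k) (cong choose2 (m+n∸n≡m 2 k))

  counts-third : ∀ {o} → ascentsFrom k l ≡ indicator o → counts (k ∷ map (punchInℕ k) l) ≡
    (indicator o + countTriples is123 l , indicator (not o) + countTriples is132 l)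
  counts-third {o} ascents≡o = trans (counts-insert k l) (cong₂ _,_
    (cong (_+ countTriples is123 l) ascents≡o)
    (cong (_+ countTriples is132 l) (indicator-complement o (trans (cong (_+ descentsFrom k l) (sym ascents≡o)) ascents+descents-third))))

  3≤counts-below : ∀ x → x < k →
    3 ≤ countTriples is123 (x ∷ map (punchInℕ x) l) + countTriples is132 (x ∷ map (punchInℕ x) l)
  3≤counts-below x x<k rewrite count123-insert x l | count132-insert x l = begin
    3                                           ≤⟨ 3≤choose2 (m+n≤o⇒m≤o∸n 3 (s≤s (s≤s x<k))) ⟩
    choose2 (2 + k ∸ x)                         ≡⟨ ascents+descents σ x ⟨
    ascentsFrom x l + descentsFrom x l          ≤⟨ +-mono-≤ (m≤m+n (ascentsFrom x l) _) (m≤m+n (descentsFrom x l) _) ⟩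
    (ascentsFrom x l + countTriples is123 l) + (descentsFrom x l + countTriples is132 l) ∎
    where open ≤-Reasoning

  stats-largest : ∀ {a b o} → HasStats k l a b o → HasStats (suc k) (2 + k ∷ map (punchInℕ (2 + k)) l) a b false
  stats-largest (c , _) = trans counts-largest c , order-largest

  stats-largest⁻ : ∀ {a b o} → HasStats (suc k) (2 + k ∷ map (punchInℕ (2 + k)) l) a b o →
    o ≡ false × counts l ≡ (indicator a , indicator b)
  stats-largest⁻ (c , o) = indicator-injective (trans (sym o) order-largest) , trans (sym counts-largest) c

  stats-second : ∀ {a b o} → HasStats k l a b o → HasStats (suc k) (1 + k ∷ map (punchInℕ (1 + k)) l) a b true
  stats-second (c , _) = trans counts-second c , order-second

  stats-second⁻ : ∀ {a b o} → HasStats (suc k) (1 + k ∷ map (punchInℕ (1 + k)) l) a b o →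
    o ≡ true × counts l ≡ (indicator a , indicator b)
  stats-second⁻ (c , o) = indicator-injective (trans (sym o) order-second) , trans (sym counts-second) c

  stats-third-false : ∀ {a} → HasStats k l a false false → HasStats (suc k) (k ∷ map (punchInℕ k) l) a true false
  stats-third-false (c , o) = trans (counts-third o) (cong₂ _,_ (,-injectiveˡ c) (cong suc (,-injectiveʳ c))) , trans order-third o

  stats-third-true : ∀ {b} → HasStats k l false b true → HasStats (suc k) (k ∷ map (punchInℕ k) l) true b true
  stats-third-true (c , o) = trans (counts-third o) (cong₂ _,_ (cong suc (,-injectiveˡ c)) (,-injectiveʳ c)) , trans order-third o

  stats-third-false⁻ : ∀ {a b} → HasStats (suc k) (k ∷ map (punchInℕ k) l) a b false → b ≡ true × HasStats k l a false false
  stats-third-false⁻ {b = b} (c , o) = proj₁ split-b , (cong₂ _,_ (,-injectiveˡ c′) (proj₂ split-b) , ascents≡0)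
    where
    ascents≡0 = trans (sym order-third) o
    c′ = trans (sym (counts-third ascents≡0)) c
    split-b = suc≡indicator b (,-injectiveʳ c′)

  stats-third-true⁻ : ∀ {a b} → HasStats (suc k) (k ∷ map (punchInℕ k) l) a b true → a ≡ true × HasStats k l false b true
  stats-third-true⁻ {a = a} (c , o) = proj₁ split-a , (cong₂ _,_ (proj₂ split-a) (,-injectiveʳ c′) , ascents≡1)
    where
    ascents≡1 = trans (sym order-third) o
    c′ = trans (sym (counts-third ascents≡1)) c
    split-a = suc≡indicator a (,-injectiveˡ c′)

  no-stats-below : ∀ {a b o} x → x < k → ¬ HasStats (suc k) (x ∷ map (punchInℕ x) l) a b o
  no-stats-below {a} {b} x x<k (c , _) = <⇒≱ (s≤s (s≤s (s≤s z≤n))) (begin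
    3                   ≤⟨ 3≤counts-below x x<k ⟩
    _                   ≡⟨ cong₂ _+_ (,-injectiveˡ c) (,-injectiveʳ c) ⟩
    indicator a + indicator b ≤⟨ +-mono-≤ (indicator≤1 a) (indicator≤1 b) ⟩
    2                   ∎)
    where open ≤-Reasoning

-- The enumeration

Profile : ∀ k → Vec (Fin (2 + k)) (2 + k) → Bool → Bool → Bool → Set
Profile k π a b o = IsPermutation π × HasStats k (values π) a b o

largest second third : ∀ k → Fin (3 + k)
largest k = Fin.fromℕ< (n<1+n (2 + k))
second  k = Fin.fromℕ< (s≤s (s≤s (n≤1+n k)))
third   k = Fin.fromℕ< (s≤s (m≤n+m k 2))

toℕ-largest : ∀ k → toℕ (largest k) ≡ 2 + k
toℕ-largest k = toℕ-fromℕ< (n<1+n (2 + k))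

toℕ-second : ∀ k → toℕ (second k) ≡ 1 + k
toℕ-second k = toℕ-fromℕ< (s≤s (s≤s (n≤1+n k)))

toℕ-third : ∀ k → toℕ (third k) ≡ k
toℕ-third k = toℕ-fromℕ< (s≤s (m≤n+m k 2))

enum    : ∀ k → Bool → Bool → Bool → List (Vec (Fin (2 + k)) (2 + k))
enumAny : ∀ k → Bool → Bool → List (Vec (Fin (2 + k)) (2 + k))

enum zero    false false true  = (Fin.zero Vec.∷ Fin.suc Fin.zero Vec.∷ Vec.[]) ∷ []
enum zero    false false false = (Fin.suc Fin.zero Vec.∷ Fin.zero Vec.∷ Vec.[]) ∷ []
enum zero    _     _     _     = []
enum (suc k) a b false = map (prepend (largest k)) (enumAny k a b)
                      ++ (if b then map (prepend (third k)) (enum k a false false) else [])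
enum (suc k) a b true  = map (prepend (second k)) (enumAny k a b)
                      ++ (if a then map (prepend (third k)) (enum k false b true) else [])

enumAny k a b = enum k a b true ++ enum k a b false

prepend-stats : ∀ {k a b o} x (σ : Vec (Fin (2 + k)) (2 + k)) {v} → toℕ x ≡ v →
  Profile (suc k) (prepend x σ) a b o → HasStats (suc k) (v ∷ map (punchInℕ v) (values σ)) a b o
prepend-stats {k} {a} {b} {o} x σ x≡v (_ , st) = subst (λ l → HasStats (suc k) l a b o) (values-prepend x σ x≡v) st

profile-prepend : ∀ {k a b o a′ b′ o′} x (σ : Vec (Fin (2 + k)) (2 + k)) {v} → toℕ x ≡ v →
  (∀ {l} → PermList (2 + k) l → HasStats k l a b o → HasStats (suc k) (v ∷ map (punchInℕ v) l) a′ b′ o′) →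
  Profile k σ a b o → Profile (suc k) (prepend x σ) a′ b′ o′
profile-prepend {k} {a′ = a′} {b′} {o′} x σ x≡v stats-step (pσ , st) = prepend-isPermutation x pσ ,
  subst (λ l → HasStats (suc k) l a′ b′ o′) (sym (values-prepend x σ x≡v)) (stats-step (isPermutation⇒PermList σ pσ) st)

empty-isPermutation : IsPermutation {0} Vec.[]
empty-isPermutation {()}

sound : ∀ k {a b o} π → π ∈ enum k a b o → Profile k π a b o
sound zero {false} {false} {true}  _ (here refl) =
  prepend-isPermutation Fin.zero (prepend-isPermutation Fin.zero empty-isPermutation) , refl , refl
sound zero {false} {false} {false} _ (here refl) =
  prepend-isPermutation (Fin.suc Fin.zero) (prepend-isPermutation Fin.zero empty-isPermutation) , refl , refl
sound (suc k) {a} {b} {false} π π∈ with ∈-++⁻ (map (prepend (largest k)) (enumAny k a b)) π∈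
... | inj₁ π∈₁ with ∈-map⁻ (prepend (largest k)) π∈₁
...   | σ , σ∈ , refl = [ prepend-largest , prepend-largest ]′ (∈-++⁻ (enum k a b true) σ∈)
  where
  prepend-largest : ∀ {o} → σ ∈ enum k a b o → Profile (suc k) (prepend (largest k) σ) a b false
  prepend-largest σ∈′ = profile-prepend (largest k) σ (toℕ-largest k) (λ τ → Insertion.stats-largest τ) (sound k σ σ∈′)
sound (suc k) {a} {true} {false} π π∈ | inj₂ π∈₂ with ∈-map⁻ (prepend (third k)) π∈₂
... | σ , σ∈ , refl = profile-prepend (third k) σ (toℕ-third k) (λ τ → Insertion.stats-third-false τ) (sound k σ σ∈)
sound (suc k) {a} {b} {true} π π∈ with ∈-++⁻ (map (prepend (second k)) (enumAny k a b)) π∈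
... | inj₁ π∈₁ with ∈-map⁻ (prepend (second k)) π∈₁
...   | σ , σ∈ , refl = [ prepend-second , prepend-second ]′ (∈-++⁻ (enum k a b true) σ∈)
  where
  prepend-second : ∀ {o} → σ ∈ enum k a b o → Profile (suc k) (prepend (second k) σ) a b true
  prepend-second σ∈′ = profile-prepend (second k) σ (toℕ-second k) (λ τ → Insertion.stats-second τ) (sound k σ σ∈′)
sound (suc k) {true} {b} {true} π π∈ | inj₂ π∈₂ with ∈-map⁻ (prepend (third k)) π∈₂
... | σ , σ∈ , refl = profile-prepend (third k) σ (toℕ-third k) (λ τ → Insertion.stats-third-true τ) (sound k σ σ∈)

data HeadView (k : ℕ) : Fin (3 + k) → Set where
  at-largest : HeadView k (largest k)
  at-second  : HeadView k (second k)
  at-third   : HeadView k (third k)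
  below      : ∀ {x} → toℕ x < k → HeadView k x

headView : ∀ k x → HeadView k x
headView k x with toℕ x ≟ 2 + k | toℕ x ≟ 1 + k | toℕ x ≟ k
... | yes x≡2+k | _         | _       = subst (HeadView k) (toℕ-injective (trans (toℕ-largest k) (sym x≡2+k))) at-largest
... | no  _     | yes x≡1+k | _       = subst (HeadView k) (toℕ-injective (trans (toℕ-second k) (sym x≡1+k))) at-second
... | no  _     | no  _     | yes x≡k = subst (HeadView k) (toℕ-injective (trans (toℕ-third k) (sym x≡k))) at-third
... | no  x≢2+k | no  x≢1+k | no  x≢k =
  below (≤∧≢⇒< (≤-pred (≤∧≢⇒< (≤-pred (≤∧≢⇒< (≤-pred (toℕ<n x)) x≢2+k)) x≢1+k)) x≢k)

module Completeness (k : ℕ) (complete-k : ∀ {a b o} σ → Profile k σ a b o → σ ∈ enum k a b o) where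

  ∈-enumAny : ∀ {a b} σ → IsPermutation σ → counts (values σ) ≡ (indicator a , indicator b) → σ ∈ enumAny k a b
  ∈-enumAny {a} {b} σ pσ c with +≡1⇒indicator _ (Insertion.ascents+descents-third (isPermutation⇒PermList σ pσ))
  ... | true  , o = ∈-++⁺ˡ (complete-k σ (pσ , c , o))
  ... | false , o = ∈-++⁺ʳ (enum k a b true) (complete-k σ (pσ , c , o))

  complete-prepend : ∀ {a b o x} σ → HeadView k x → IsPermutation σ → Profile (suc k) (prepend x σ) a b o →
    prepend x σ ∈ enum (suc k) a b o
  complete-prepend σ at-largest pσ p
    with Insertion.stats-largest⁻ (isPermutation⇒PermList σ pσ) (prepend-stats (largest k) σ (toℕ-largest k) p)
  ... | refl , c = ∈-++⁺ˡ (∈-map⁺ (prepend (largest k)) (∈-enumAny σ pσ c))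
  complete-prepend σ at-second pσ p
    with Insertion.stats-second⁻ (isPermutation⇒PermList σ pσ) (prepend-stats (second k) σ (toℕ-second k) p)
  ... | refl , c = ∈-++⁺ˡ (∈-map⁺ (prepend (second k)) (∈-enumAny σ pσ c))
  complete-prepend {a} {o = false} σ at-third pσ p
    with Insertion.stats-third-false⁻ (isPermutation⇒PermList σ pσ) (prepend-stats (third k) σ (toℕ-third k) p)
  ... | refl , st = ∈-++⁺ʳ (map (prepend (largest k)) (enumAny k a true)) (∈-map⁺ (prepend (third k)) (complete-k σ (pσ , st)))
  complete-prepend {b = b} {o = true} σ at-third pσ p
    with Insertion.stats-third-true⁻ (isPermutation⇒PermList σ pσ) (prepend-stats (third k) σ (toℕ-third k) p)
  ... | refl , st = ∈-++⁺ʳ (map (prepend (second k)) (enumAny k true b)) (∈-map⁺ (prepend (third k)) (complete-k σ (pσ , st)))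
  complete-prepend {x = x} σ (below x<k) pσ p = contradiction
    (prepend-stats x σ refl p) (Insertion.no-stats-below (isPermutation⇒PermList σ pσ) (toℕ x) x<k)

complete : ∀ k {a b o} π → Profile k π a b o → π ∈ enum k a b o
complete zero {true}         (_ Vec.∷ _ Vec.∷ Vec.[]) (_ , () , _)
complete zero {false} {true} (_ Vec.∷ _ Vec.∷ Vec.[]) (_ , () , _)
complete zero {false} {false} {true}  (Fin.zero Vec.∷ Fin.suc Fin.zero Vec.∷ Vec.[]) _ = here refl
complete zero {false} {false} {false} (Fin.suc Fin.zero Vec.∷ Fin.zero Vec.∷ Vec.[]) _ = here refl
complete zero {false} {false} {false} (Fin.zero Vec.∷ Fin.suc Fin.zero Vec.∷ Vec.[]) (_ , _ , ())
complete zero {false} {false} {true}  (Fin.suc Fin.zero Vec.∷ Fin.zero Vec.∷ Vec.[]) (_ , _ , ())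
complete zero (Fin.zero Vec.∷ Fin.zero Vec.∷ Vec.[]) (pπ , _) =
  contradiction (pπ {Fin.zero} {Fin.suc Fin.zero} refl) λ ()
complete zero (Fin.suc Fin.zero Vec.∷ Fin.suc Fin.zero Vec.∷ Vec.[]) (pπ , _) =
  contradiction (pπ {Fin.zero} {Fin.suc Fin.zero} refl) λ ()
complete (suc k) π (pπ , st) with prepend-surjective π pπ
... | x , σ , pσ , refl = Completeness.complete-prepend k (complete k) σ (headView k x) pσ (pπ , st)

enum-order-disjoint : ∀ k a b → Disjoint (enum k a b true) (enum k a b false)
enum-order-disjoint k a b (π∈₁ , π∈₂) with trans (sym (proj₂ (proj₂ (sound k _ π∈₁)))) (proj₂ (proj₂ (sound k _ π∈₂)))
... | ()

prepend-disjoint : ∀ {m} {x y : Fin (suc m)} → x ≢ y → (A B : List (Vec (Fin m) m)) →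
  Disjoint (map (prepend x) A) (map (prepend y) B)
prepend-disjoint {x = x} {y} x≢y A B (π∈₁ , π∈₂) with ∈-map⁻ (prepend x) π∈₁ | ∈-map⁻ (prepend y) π∈₂
... | σ , _ , π≡xσ | τ , _ , π≡yτ = x≢y (∷-injectiveˡ (trans (sym π≡xσ) π≡yτ))

largest≢third : ∀ k → largest k ≢ third k
largest≢third k e = <-irrefl (sym (fromℕ<-injective (2 + k) k (n<1+n (2 + k)) (s≤s (m≤n+m k 2)) e)) (<-trans (n<1+n k) (n<1+n (1 + k)))

second≢third : ∀ k → second k ≢ third k
second≢third k e = <-irrefl (sym (fromℕ<-injective (1 + k) k (s≤s (s≤s (n≤1+n k))) (s≤s (m≤n+m k 2)) e)) (n<1+n k)

unique-enum    : ∀ k a b o → Unique (enum k a b o)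
unique-enumAny : ∀ k a b → Unique (enumAny k a b)

unique-enum zero    false false true  = [] ∷ []
unique-enum zero    false false false = [] ∷ []
unique-enum zero    true  _     _     = []
unique-enum zero    false true  _     = []
unique-enum (suc k) a     false false = ++⁺ (map⁺ (prepend-injectiveʳ (largest k)) (unique-enumAny k a false)) [] λ ()
unique-enum (suc k) a     true  false = ++⁺ (map⁺ (prepend-injectiveʳ (largest k)) (unique-enumAny k a true))
  (map⁺ (prepend-injectiveʳ (third k)) (unique-enum k a false false))
  (prepend-disjoint (largest≢third k) (enumAny k a true) (enum k a false false))
unique-enum (suc k) false b     true  = ++⁺ (map⁺ (prepend-injectiveʳ (second k)) (unique-enumAny k false b)) [] λ ()
unique-enum (suc k) true  b     true  = ++⁺ (map⁺ (prepend-injectiveʳ (second k)) (unique-enumAny k true b))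
  (map⁺ (prepend-injectiveʳ (third k)) (unique-enum k false b true))
  (prepend-disjoint (second≢third k) (enumAny k true b) (enum k false b true))

unique-enumAny k a b = ++⁺ (unique-enum k a b true) (unique-enum k a b false) (enum-order-disjoint k a b)

length-if-map : ∀ {A B : Set} b (f : A → B) xs → length (if b then map f xs else []) ≡ (if b then length xs else 0)
length-if-map true  f xs = length-map f xs
length-if-map false f xs = refl

length-enum-true : ∀ k a b →
  length (enum (suc k) a b true) ≡ length (enumAny k a b) + (if a then length (enum k false b true) else 0)
length-enum-true k a b = trans (length-++ (map (prepend (second k)) (enumAny k a b)))
  (cong₂ _+_ (length-map (prepend (second k)) (enumAny k a b)) (length-if-map a (prepend (third k)) (enum k false b true)))

length-enum-false : ∀ k a b →
  length (enum (suc k) a b false) ≡ length (enumAny k a b) + (if b then length (enum k a false false) else 0)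
length-enum-false k a b = trans (length-++ (map (prepend (largest k)) (enumAny k a b)))
  (cong₂ _+_ (length-map (prepend (largest k)) (enumAny k a b)) (length-if-map b (prepend (third k)) (enum k a false false)))

length-enum-avoiding : ∀ k → length (enum k false false true) ≡ 2 ^ k × length (enum k false false false) ≡ 2 ^ k
length-enum-avoiding zero    = refl , refl
length-enum-avoiding (suc k) =
  trans (length-enum-true k false false) length-enumAny≡ ,
  trans (length-enum-false k false false) length-enumAny≡
  where
  length-enumAny≡ : length (enumAny k false false) + 0 ≡ 2 ^ suc k
  length-enumAny≡ = begin
    length (enumAny k false false) + 0                              ≡⟨ +-identityʳ _ ⟩
    length (enumAny k false false)                                  ≡⟨ length-++ (enum k false false true) ⟩
    length (enum k false false true) + length (enum k false false false) ≡⟨ cong₂ _+_ (proj₁ (length-enum-avoiding k)) (proj₂ (length-enum-avoiding k)) ⟩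
    2 ^ k + 2 ^ k                                                   ≡⟨ cong (2 ^ k +_) (+-identityʳ (2 ^ k)) ⟨
    2 ^ suc k ∎
    where open ≡-Reasoning

length-enumAny-suc : ∀ k a b → length (enumAny (suc k) a b) ≡
  (length (enumAny k a b) + (if a then length (enum k false b true) else 0)) +
  (length (enumAny k a b) + (if b then length (enum k a false false) else 0))
length-enumAny-suc k a b =
  trans (length-++ (enum (suc k) a b true)) (cong₂ _+_ (length-enum-true k a b) (length-enum-false k a b))

-- Scaled by 2 (by 8 for both patterns) so that the exponent of 2 stays natural for small k.
length-enumAny-123 : ∀ k → 2 * length (enumAny k true false) ≡ k * 2 ^ k
length-enumAny-123 zero    = refl
length-enumAny-123 (suc k) = begin
  2 * length (enumAny (suc k) true false)                         ≡⟨ cong (2 *_) (length-enumAny-suc k true false) ⟩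
  2 * ((N + length (enum k false false true)) + (N + 0))           ≡⟨ cong (λ m → 2 * ((N + m) + (N + 0))) (proj₁ (length-enum-avoiding k)) ⟩
  2 * ((N + 2 ^ k) + (N + 0))                                     ≡⟨ lhs≡ N (2 ^ k) ⟩
  2 * N + 2 * N + 2 * 2 ^ k                                       ≡⟨ cong (λ m → m + m + 2 * 2 ^ k) (length-enumAny-123 k) ⟩
  k * 2 ^ k + k * 2 ^ k + 2 * 2 ^ k                               ≡⟨ rhs≡ k (2 ^ k) ⟩
  suc k * 2 ^ suc k                                               ∎
  where
  open ≡-Reasoning
  N = length (enumAny k true false)
  lhs≡ : ∀ n p → 2 * ((n + p) + (n + 0)) ≡ 2 * n + 2 * n + 2 * p
  lhs≡ = solve-∀
  rhs≡ : ∀ k p → k * p + k * p + 2 * p ≡ suc k * (2 * p)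
  rhs≡ = solve-∀

length-enumAny-132 : ∀ k → 2 * length (enumAny k false true) ≡ k * 2 ^ k
length-enumAny-132 zero    = refl
length-enumAny-132 (suc k) = begin
  2 * length (enumAny (suc k) false true)                         ≡⟨ cong (2 *_) (length-enumAny-suc k false true) ⟩
  2 * ((N + 0) + (N + length (enum k false false false)))         ≡⟨ cong (λ m → 2 * ((N + 0) + (N + m))) (proj₂ (length-enum-avoiding k)) ⟩
  2 * ((N + 0) + (N + 2 ^ k))                                     ≡⟨ lhs≡ N (2 ^ k) ⟩
  2 * N + 2 * N + 2 * 2 ^ k                                       ≡⟨ cong (λ m → m + m + 2 * 2 ^ k) (length-enumAny-132 k) ⟩
  k * 2 ^ k + k * 2 ^ k + 2 * 2 ^ k                               ≡⟨ rhs≡ k (2 ^ k) ⟩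
  suc k * 2 ^ suc k                                               ∎
  where
  open ≡-Reasoning
  N = length (enumAny k false true)
  lhs≡ : ∀ n p → 2 * ((n + 0) + (n + p)) ≡ 2 * n + 2 * n + 2 * p
  lhs≡ = solve-∀
  rhs≡ : ∀ k p → k * p + k * p + 2 * p ≡ suc k * (2 * p)
  rhs≡ = solve-∀

length-enumAny-123-132 : ∀ k → 8 * length (enumAny (2 + k) true true) ≡ (1 + k) * k * 2 ^ (2 + k)
length-enumAny-123-132 zero    = refl
length-enumAny-123-132 (suc k) = begin
  8 * length (enumAny (3 + k) true true)
    ≡⟨ cong (8 *_) (length-enumAny-suc (2 + k) true true) ⟩
  8 * ((N + length (enum (2 + k) false true true)) + (N + length (enum (2 + k) true false false)))
    ≡⟨ cong₂ (λ m m′ → 8 * ((N + m) + (N + m′))) (length-enum-true (1 + k) false true) (length-enum-false (1 + k) true false) ⟩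
  8 * ((N + (N₁₃₂ + 0)) + (N + (N₁₂₃ + 0)))
    ≡⟨ lhs≡ N N₁₃₂ N₁₂₃ ⟩
  2 * (8 * N) + 4 * (2 * N₁₃₂) + 4 * (2 * N₁₂₃)
    ≡⟨ cong₂ (λ m m′ → 2 * m + 4 * m′ + 4 * (2 * N₁₂₃)) (length-enumAny-123-132 k) (length-enumAny-132 (1 + k)) ⟩
  2 * ((1 + k) * k * 2 ^ (2 + k)) + 4 * ((1 + k) * 2 ^ (1 + k)) + 4 * (2 * N₁₂₃)
    ≡⟨ cong (λ m → 2 * ((1 + k) * k * 2 ^ (2 + k)) + 4 * ((1 + k) * 2 ^ (1 + k)) + 4 * m) (length-enumAny-123 (1 + k)) ⟩
  2 * ((1 + k) * k * 2 ^ (2 + k)) + 4 * ((1 + k) * 2 ^ (1 + k)) + 4 * ((1 + k) * 2 ^ (1 + k))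
    ≡⟨ rhs≡ k (2 ^ k) ⟩
  (2 + k) * (1 + k) * 2 ^ (3 + k) ∎
  where
  open ≡-Reasoning
  N    = length (enumAny (2 + k) true true)
  N₁₃₂ = length (enumAny (1 + k) false true)
  N₁₂₃ = length (enumAny (1 + k) true false)
  lhs≡ : ∀ n x y → 8 * ((n + (x + 0)) + (n + (y + 0))) ≡ 2 * (8 * n) + 4 * (2 * x) + 4 * (2 * y)
  lhs≡ = solve-∀
  rhs≡ : ∀ k p → 2 * ((1 + k) * k * (2 * (2 * p))) + 4 * ((1 + k) * (2 * p)) + 4 * ((1 + k) * (2 * p))
                 ≡ (2 + k) * (1 + k) * (2 * (2 * (2 * p)))
  rhs≡ = solve-∀

∈-enumAny⇔ : ∀ k a b π → π ∈ enumAny k a b ⇔ (IsPermutation π × counts (values π) ≡ (indicator a , indicator b))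
∈-enumAny⇔ k a b π = mk⇔
  ([ permutation-counts , permutation-counts ]′ ∘ ∈-++⁻ (enum k a b true))
  (λ p → Completeness.∈-enumAny k (complete k) π (proj₁ p) (proj₂ p))
  where
  permutation-counts : ∀ {o} → π ∈ enum k a b o → IsPermutation π × counts (values π) ≡ (indicator a , indicator b)
  permutation-counts = map₂ proj₁ ∘ sound k π

theorem3 : (n : ℕ) → 5 ≤ n →
    Σ (List (Vec (Fin n) n)) (λ L →
      Unique L ×
      ((π : Vec (Fin n) n) → (π ∈ L) ⇔ (IsPermutation π × (count132 π ≡ 1) × (count123 π ≡ 1))) ×
      (length L ≡ (n ∸ 3) * (n ∸ 4) * 2 ^ (n ∸ 5)))
theorem3 n 5≤n with m≤n⇒∃[o]m+o≡n 5≤n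
... | j , refl = enumAny (3 + j) true true , unique-enumAny (3 + j) true true , ∈⇔ , length≡
  where
  ∈⇔ : ∀ π → π ∈ enumAny (3 + j) true true ⇔ (IsPermutation π × count132 π ≡ 1 × count123 π ≡ 1)
  ∈⇔ π = mk⇔ (map₂ split ∘ Equivalence.to E) (Equivalence.from E ∘ map₂ join)
    where
    E = ∈-enumAny⇔ (3 + j) true true π
    split : counts (values π) ≡ (1 , 1) → count132 π ≡ 1 × count123 π ≡ 1
    split c = ,-injectiveʳ (trans (sym (counts-values π)) c) , ,-injectiveˡ (trans (sym (counts-values π)) c)
    join : count132 π ≡ 1 × count123 π ≡ 1 → counts (values π) ≡ (1 , 1)
    join (c132 , c123) = trans (counts-values π) (cong₂ _,_ c123 c132)
  length≡ : length (enumAny (3 + j) true true) ≡ (2 + j) * (1 + j) * 2 ^ j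
  length≡ = *-cancelˡ-≡ _ _ 8 (trans (length-enumAny-123-132 (1 + j)) (factor-8 ((2 + j) * (1 + j)) (2 ^ j)))
    where
    factor-8 : ∀ c p → c * (2 * (2 * (2 * p))) ≡ 8 * (c * p)
    factor-8 = solve-∀
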